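{- For all $m,k\in\mathbb{N}_0$ with $m>k$ we have $\mathrm{whd}(\mathrm{OFPHP}^m_k)\ge k$.
   Context: Literals are variables $v$ or negations $\overline{v}$; clauses finite sets of literals without complementary pair; clause-sets finite sets of clauses; $\bot$ empty clause. Unsatisfiable: no assignment satisfies all clauses. For $m,k\in\mathbb{N}_0$, with distinct variables $p_{i,j}$: $\mathrm{PHP}^m_k$ consists of the clauses $\{p_{i,1},\dots,p_{i,k}\}$ for $i\in\{1,\dots,m\}$ and $\{\overline{p_{i_1,j}},\overline{p_{i_2,j}}\}$ for $j\in\{1,\dots,k\}$, $i_1\ne i_2\in\{1,\dots,m\}$. $\mathrm{OFPHP}^m_k$ is $\mathrm{PHP}^m_k$ together with the clauses $\{\overline{p_{i,j_1}},\overline{p_{i,j_2}}\}$ for $i\in\{1,\dots,m\}$, $j_1\neq j_2\in\{1,\dots,k\}$, and $\{p_{1,j},\dots,p_{m,j}\}$ for $j\in\{1,\dots,k\}$. Resolution: $C,D$ with exactly one clash $x\in C,\overline{x}\in D$ have resolvent $(C\cup D)\setminus\{x,\overline{x}\}$. Resolution tree: finite rooted tree, inner nodes with two children, labelled by clauses, inner labels resolvents of children's labels; refutation of $F$: leaves in $F$, root $\bot$. Asymmetric width: $\mathrm{whd}(T)=0$ for a single node; otherwise, with root children labelled $C_1,C_2$ and subtrees $T_1,T_2$, $\mathrm{whd}(T)=\max(\mathrm{whd}(T_1),\mathrm{whd}(T_2),\min(|C_1|,|C_2|))$; for unsatisfiable $F$, $\mathrm{whd}(F)$ is the minimum over refutations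 of $F$. -}

module Defs where

open import Data.Nat using (ℕ; zero; suc; _⊔_; _⊓_; _≟_)
open import Data.Product using (_×_; _,_; Σ; ∃; ∃-syntax)
open import Data.List using (List; []; _∷_; map; concatMap; upTo; filter; length)
open import Data.List.Membership.Propositional using (_∈_)
open import Data.List.Relation.Unary.All using (All)
open import Data.List.Relation.Unary.Any using (Any)
open import Data.List.Relation.Unary.Unique.Propositional using (Unique)
open import Relation.Binary.PropositionalEquality using (_≡_)
open import Relation.Nullary using (¬_; ¬?)
open import Function.Bundles using (_⇔_)
open import Data.Sum using (_⊎_)

data Lit (V : Set) : Set where
  pos : V → Lit V
  neg : V → Lit V

compl : {V : Set} → Lit V → Lit V
compl (pos v) = neg v
compl (neg v) = pos v

-- A clause is represented by a duplicate-free list of literals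
-- (so that its length is the cardinality of the finite set).
Clause : Set → Set
Clause V = List (Lit V)

IsClause : {V : Set} → Clause V → Set
IsClause C = Unique C × (∀ l → l ∈ C → ¬ (compl l ∈ C))

_≈_ : {V : Set} → Clause V → Clause V → Set
C ≈ D = ∀ l → (l ∈ C ⇔ l ∈ D)

ClauseSet : Set → Set
ClauseSet V = List (Clause V)

_∈CS_ : {V : Set} → Clause V → ClauseSet V → Set
C ∈CS F = Any (λ D → C ≈ D) F

Clash : {V : Set} → Clause V → Clause V → Lit V → Set
Clash C D x = x ∈ C × compl x ∈ D

IsResolvent : {V : Set} → Clause V → Clause V → Clause V → Set
IsResolvent C D R =
  ∃[ x ] (Clash C D x × (∀ y → Clash C D y → y ≡ x)
         × (∀ l → (l ∈ R ⇔ ((l ∈ C ⊎ l ∈ D) × ¬ (l ≡ x) × ¬ (l ≡ compl x)))))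

data Tree (V : Set) : Set where
  leaf : Clause V → Tree V
  node : Clause V → Tree V → Tree V → Tree V

label : {V : Set} → Tree V → Clause V
label (leaf C)     = C
label (node C _ _) = C

ValidTree : {V : Set} → Tree V → Set
ValidTree (leaf C)       = IsClause C
ValidTree (node C t₁ t₂) =
  IsClause C × IsResolvent (label t₁) (label t₂) C × ValidTree t₁ × ValidTree t₂

LeavesIn : {V : Set} → ClauseSet V → Tree V → Set
LeavesIn F (leaf C)       = C ∈CS F
LeavesIn F (node _ t₁ t₂) = LeavesIn F t₁ × LeavesIn F t₂

IsRefutation : {V : Set} → ClauseSet V → Tree V → Set
IsRefutation F T = ValidTree T × LeavesIn F T × label T ≡ []

whdT : {V : Set} → Tree V → ℕ
whdT (leaf _)       = 0
whdT (node _ t₁ t₂) =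
  whdT t₁ ⊔ whdT t₂ ⊔ (length (label t₁) ⊓ length (label t₂))

-- Pigeonhole formulas; variable p_{i,j} is (i , j) with
-- i ∈ {0..m-1}, j ∈ {0..k-1} (0-based indexing of the paper's 1..m, 1..k).

Var : Set
Var = ℕ × ℕ

distinctPairs : ℕ → List (ℕ × ℕ)
distinctPairs n =
  filter (λ { (a , b) → ¬? (a ≟ b) })
         (concatMap (λ a → map (λ b → (a , b)) (upTo n)) (upTo n))

PHP : ℕ → ℕ → ClauseSet Var
PHP m k =
  map (λ i → map (λ j → pos (i , j)) (upTo k)) (upTo m)
  Data.List.++
  concatMap (λ j → map (λ { (i₁ , i₂) → neg (i₁ , j) ∷ neg (i₂ , j) ∷ [] })
                       (distinctPairs m))
            (upTo k)
  where import Data.List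

OFPHP : ℕ → ℕ → ClauseSet Var
OFPHP m k =
  PHP m k
  Data.List.++
  concatMap (λ i → map (λ { (j₁ , j₂) → neg (i , j₁) ∷ neg (i , j₂) ∷ [] })
                       (distinctPairs k))
            (upTo m)
  Data.List.++
  map (λ j → map (λ i → pos (i , j)) (upTo m)) (upTo k)
  where import Data.List

-- The proof is a Prover–Delayer argument.  Walk from the root of a refutation
-- of width < k towards a leaf, keeping a partial matching M (pigeon i in hole j
-- read as p_{i,j} true) with fewer than k edges that falsifies the current label.
-- At a resolution on p_{i,j} we move to a premise already falsified by M if
-- there is one; otherwise p_{i,j} is free and some premise C has fewer than k
-- literals.  We then keep one witnessing edge for each literal of C other than
-- the pivot (at most |C| - 1 edges) and add one edge falsifying the pivot:
-- the edge (i, j) itself, or an edge (i', j) with a fresh pigeon i', which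
-- exists because m > k.  No axiom of OFPHP is falsified by a matching with
-- fewer than k edges: a pigeon clause would need k edges, an onto clause m > k
-- edges, and the binary clauses just say that M is a matching.  So the walk
-- never reaches a leaf.
module Submission where

open import Defs
open import Data.Nat using (ℕ; zero; suc; _<_; _≤_; z≤n; s≤s; _⊔_; _⊓_; _≟_)
open import Data.Nat.Properties
open import Data.Product using (∃; _×_; _,_; proj₁; proj₂; swap; uncurry)
open import Data.Product.Properties using (≡-dec)
open import Data.Sum using (_⊎_; inj₁; inj₂)
import Data.Sum as Sum
open import Data.Empty using (⊥-elim)
open import Data.List using (List; []; _∷_; map; length; upTo; filter; concatMap)
open import Data.List.Properties using (length-map; filter-notAll)
open import Data.List.Membership.Propositional using (_∈_; _∉_; find; lose)
open import Data.List.Membership.Propositional.Properties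
  using (∈-map⁺; ∈-map⁻; ∈-upTo⁺; ∈-upTo⁻; ∈-filter⁺; ∈-filter⁻; ∈-++⁻; ∈-concatMap⁻)
open import Data.List.Membership.DecPropositional _≟_ using (_∈?_)
open import Data.List.Relation.Binary.Subset.Propositional using (_⊆_)
open import Data.List.Relation.Binary.Subset.Propositional.Properties
  using (Any-resp-⊆; map⁺; xs⊆x∷xs; ∈-∷⁺ʳ)
open import Data.List.Relation.Unary.All as All using (All; []; _∷_)
open import Data.List.Relation.Unary.Any as Any using (Any; here; there; any?)
import Data.List.Relation.Unary.Any.Properties as Any
open import Function using (_∘_)
open import Function.Bundles using (Equivalence)
open import Relation.Binary.Definitions using (DecidableEquality)
open import Relation.Binary.PropositionalEquality
open import Relation.Nullary using (¬_; Dec; yes; no; ¬?)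
open import Relation.Nullary.Decidable using (_×-dec_; _⊎-dec_; map′; decidable-stable)

all<⇒≤length : ∀ n (xs : List ℕ) → (∀ {i} → i < n → i ∈ xs) → n ≤ length xs
all<⇒≤length zero    xs all< = z≤n
all<⇒≤length (suc n) xs all< =
  ≤-trans (s≤s (all<⇒≤length n rest rest-all<)) (filter-notAll ≢n? xs n∈xs)
  where
  ≢n? : ∀ x → Dec (x ≢ n)
  ≢n? x = ¬? (x ≟ n)
  rest : List ℕ
  rest = filter ≢n? xs
  rest-all< : ∀ {i} → i < n → i ∈ rest
  rest-all< i<n = ∈-filter⁺ ≢n? (all< (m<n⇒m<1+n i<n)) (<⇒≢ i<n)
  n∈xs : Any (λ x → ¬ x ≢ n) xs
  n∈xs = Any.map (λ n≡x x≢n → x≢n (sym n≡x)) (all< (n<1+n n))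

length<⇒∃∉ : ∀ n (xs : List ℕ) → length xs < n → ∃ λ i → i < n × i ∉ xs
length<⇒∃∉ n xs short with any? (λ i → ¬? (i ∈? xs)) (upTo n)
... | yes missing with i , i∈ , i∉ ← find missing = i , ∈-upTo⁻ i∈ , i∉
... | no none = ⊥-elim (<⇒≱ short (all<⇒≤length n xs present))
  where
  present : ∀ {i} → i < n → i ∈ xs
  present i<n = decidable-stable (_ ∈? xs) (none ∘ lose (∈-upTo⁺ i<n))

select-witnesses : ∀ {A B : Set} {R : A → B → Set} {ys : List B} (xs : List A) →
  All (λ x → Any (R x) ys) xs →
  ∃ λ zs → zs ⊆ ys × length zs ≤ length xs × All (λ x → Any (R x) zs) xs
select-witnesses []       []         = [] , (λ ()) , z≤n , []
select-witnesses (x ∷ xs) (rx ∷ rxs)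
  with y , y∈ , rxy ← find rx | zs , zs⊆ , zs≤ , rzs ← select-witnesses xs rxs =
  y ∷ zs , ∈-∷⁺ʳ y∈ zs⊆ , s≤s zs≤ , here rxy ∷ All.map (Any-resp-⊆ (xs⊆x∷xs zs y)) rzs

≟-Lit : ∀ {V : Set} → DecidableEquality V → DecidableEquality (Lit V)
≟-Lit _≟ⱽ_ (pos v) (pos w) = map′ (cong pos) (λ { refl → refl }) (v ≟ⱽ w)
≟-Lit _≟ⱽ_ (neg v) (neg w) = map′ (cong neg) (λ { refl → refl }) (v ≟ⱽ w)
≟-Lit _≟ⱽ_ (pos v) (neg w) = no λ ()
≟-Lit _≟ⱽ_ (neg v) (pos w) = no λ ()

var : ∀ {V : Set} → Lit V → V
var (pos v) = v
var (neg v) = v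

var-compl : ∀ {V : Set} (l : Lit V) → var (compl l) ≡ var l
var-compl (pos v) = refl
var-compl (neg v) = refl

valid-label : ∀ {V : Set} (T : Tree V) → ValidTree T → IsClause (label T)
valid-label (leaf C)     clause       = clause
valid-label (node C _ _) (clause , _) = clause

m⊓n<o⇒m<o⊎n<o : ∀ {m n o} → m ⊓ n < o → m < o ⊎ n < o
m⊓n<o⇒m<o⊎n<o {m} {n} m⊓n<o with ⊓-sel m n
... | inj₁ m⊓n≡m = inj₁ (subst (_< _) m⊓n≡m m⊓n<o)
... | inj₂ m⊓n≡n = inj₂ (subst (_< _) m⊓n≡n m⊓n<o)

whdT-node< : ∀ {V : Set} {C : Clause V} (t₁ t₂ : Tree V) {k} → whdT (node C t₁ t₂) < k →
  whdT t₁ < k × whdT t₂ < k × length (label t₁) ⊓ length (label t₂) < k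
whdT-node< t₁ t₂ narrow =
  let narrow₁₂ = m⊔n<o⇒m<o (whdT t₁ ⊔ whdT t₂) _ narrow
  in m⊔n<o⇒m<o _ _ narrow₁₂ , m⊔n<o⇒n<o _ _ narrow₁₂ , m⊔n<o⇒n<o (whdT t₁ ⊔ whdT t₂) _ narrow

resolvent⊆ : ∀ {V : Set} {C₁ C₂ C : Clause V} {l} →
  IsResolvent C₁ C₂ C → l ∈ C → l ∈ C₁ ⊎ l ∈ C₂
resolvent⊆ (_ , _ , _ , res) l∈ = proj₁ (Equivalence.to (res _) l∈)

resolvent⊇ : ∀ {V : Set} {C₁ C₂ C : Clause V} → IsClause C₁ → IsClause C₂ →
  IsResolvent C₁ C₂ C →
  ∃ λ x → x ∈ C₁ × compl x ∈ C₂
        × (∀ {l} → l ∈ C₁ → l ≢ x → l ∈ C) × (∀ {l} → l ∈ C₂ → l ≢ compl x → l ∈ C)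
resolvent⊇ (_ , consistent₁) (_ , consistent₂) (x , (x∈ , x̄∈) , _ , res) =
  x , x∈ , x̄∈ ,
  (λ l∈ l≢x → Equivalence.from (res _) (inj₁ l∈ , l≢x , λ { refl → consistent₁ x x∈ l∈ })) ,
  (λ l∈ l≢x̄ → Equivalence.from (res _) (inj₂ l∈ , (λ { refl → consistent₂ x l∈ x̄∈ }) , l≢x̄))

label-literals-from-leaves : ∀ {V : Set} {F : ClauseSet V} (P : Lit V → Set) →
  (∀ {C l} → C ∈CS F → l ∈ C → P l) →
  ∀ T → ValidTree T → LeavesIn F T → ∀ {l} → l ∈ label T → P l
label-literals-from-leaves P fromLeaf (leaf C) _ leafC l∈ = fromLeaf leafC l∈
label-literals-from-leaves P fromLeaf (node C t₁ t₂) (_ , res , v₁ , v₂) (lv₁ , lv₂) l∈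
  with resolvent⊆ res l∈
... | inj₁ l∈₁ = label-literals-from-leaves P fromLeaf t₁ v₁ lv₁ l∈₁
... | inj₂ l∈₂ = label-literals-from-leaves P fromLeaf t₂ v₂ lv₂ l∈₂

-- Partial matchings

_≟ⱽ_ : DecidableEquality Var
_≟ⱽ_ = ≡-dec _≟_ _≟_

_≟ᴸ_ : DecidableEquality (Lit Var)
_≟ᴸ_ = ≟-Lit _≟ⱽ_

record IsMatching (M : List Var) : Set where
  field
    functional : ∀ {a b b′} → (a , b) ∈ M → (a , b′) ∈ M → b ≡ b′
    injective  : ∀ {a a′ b} → (a , b) ∈ M → (a′ , b) ∈ M → a ≡ a′
open IsMatching

pigeons holes : List Var → List ℕ
pigeons = map proj₁
holes   = map proj₂

-- A matching M is read as the partial assignment that makes its edges true and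
-- every edge sharing exactly one endpoint with an edge of M false.
Blocks : Lit Var → Var → Set
Blocks (pos (a , b)) (c , d) = (c ≡ a × d ≢ b) ⊎ (d ≡ b × c ≢ a)
Blocks (neg v)       e       = v ≡ e

Falsified : List Var → Lit Var → Set
Falsified M l = Any (Blocks l) M

Falsified? : ∀ M l → Dec (Falsified M l)
Falsified? M l = any? (blocks? l) M
  where
  blocks? : ∀ l e → Dec (Blocks l e)
  blocks? (pos (a , b)) (c , d) = (c ≟ a ×-dec ¬? (d ≟ b)) ⊎-dec (d ≟ b ×-dec ¬? (c ≟ a))
  blocks? (neg v)       e       = v ≟ⱽ e

FalsifiedExcept : List Var → Clause Var → Lit Var → Set
FalsifiedExcept M D l = ∀ {l′} → l′ ∈ D → l′ ≢ l → Falsified M l′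

falsify-pivot : ∀ {M D l} → Falsified M l → FalsifiedExcept M D l → All (Falsified M) D
falsify-pivot {l = l} fal-l others = All.tabulate falsified
  where
  falsified : ∀ {l′} → l′ ∈ _ → Falsified _ l′
  falsified {l′} l′∈ with l′ ≟ᴸ l
  ... | yes refl = fal-l
  ... | no l′≢l  = others l′∈ l′≢l

shrink-witnesses : ∀ {M D l} → l ∈ D → FalsifiedExcept M D l →
  ∃ λ M′ → M′ ⊆ M × length M′ < length D × FalsifiedExcept M′ D l
shrink-witnesses {M} {D} {l} l∈D others =
  let M′ , M′⊆M , M′≤ , fal-D′ = select-witnesses (filter ≢l? D)
                                   (All.tabulate (λ p → uncurry others (∈-filter⁻ ≢l? p)))
  in M′ , M′⊆M , ≤-<-trans M′≤ (filter-notAll ≢l? D (lose l∈D (λ l≢l → l≢l refl))) ,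
     λ l′∈ l′≢l → All.lookup fal-D′ (∈-filter⁺ ≢l? l′∈ l′≢l)
  where
  ≢l? : ∀ l′ → Dec (l′ ≢ l)
  ≢l? l′ = ¬? (l′ ≟ᴸ l)

Free : List Var → Var → Set
Free M (a , b) = a ∉ pigeons M × b ∉ holes M

free-⊆ : ∀ {M M′ v} → M′ ⊆ M → Free M v → Free M′ v
free-⊆ M′⊆M (a∉ , b∉) = a∉ ∘ map⁺ proj₁ M′⊆M , b∉ ∘ map⁺ proj₂ M′⊆M

unassigned⇒free : ∀ {M a b} → (a , b) ∉ M → ¬ Falsified M (pos (a , b)) → Free M (a , b)
unassigned⇒free {M} {a} {b} ab∉ ¬fal = a∉ , b∉
  where
  a∉ : a ∉ pigeons M
  a∉ a∈ with ∈-map⁻ proj₁ a∈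
  ... | (_ , d) , ad∈ , refl with d ≟ b
  ...   | yes refl = ab∉ ad∈
  ...   | no d≢b   = ¬fal (lose ad∈ (inj₁ (refl , d≢b)))
  b∉ : b ∉ holes M
  b∉ b∈ with ∈-map⁻ proj₂ b∈
  ... | (c , _) , cb∈ , refl with c ≟ a
  ...   | yes refl = ab∉ cb∈
  ...   | no c≢a   = ¬fal (lose cb∈ (inj₂ (refl , c≢a)))

undecided⇒free : ∀ {M} l → ¬ Falsified M l → ¬ Falsified M (compl l) → Free M (var l)
undecided⇒free (pos v) ¬fal ¬falᶜ = unassigned⇒free ¬falᶜ ¬fal
undecided⇒free (neg v) ¬fal ¬falᶜ = unassigned⇒free ¬fal ¬falᶜ

∷-matching : ∀ {M a b} → IsMatching M → Free M (a , b) → IsMatching ((a , b) ∷ M)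
∷-matching {M} {a} {b} mat (a∉ , b∉) = record { functional = fun ; injective = inj }
  where
  fun : ∀ {x y y′} → (x , y) ∈ (a , b) ∷ M → (x , y′) ∈ (a , b) ∷ M → y ≡ y′
  fun (here refl) (here refl) = refl
  fun (here refl) (there p)   = ⊥-elim (a∉ (∈-map⁺ proj₁ p))
  fun (there p)   (here refl) = ⊥-elim (a∉ (∈-map⁺ proj₁ p))
  fun (there p)   (there q)   = functional mat p q
  inj : ∀ {x x′ y} → (x , y) ∈ (a , b) ∷ M → (x′ , y) ∈ (a , b) ∷ M → x ≡ x′
  inj (here refl) (here refl) = refl
  inj (here refl) (there q)   = ⊥-elim (b∉ (∈-map⁺ proj₂ q))
  inj (there p)   (here refl) = ⊥-elim (b∉ (∈-map⁺ proj₂ p))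
  inj (there p)   (there q)   = injective mat p q

⊆-matching : ∀ {M M′} → IsMatching M → M′ ⊆ M → IsMatching M′
⊆-matching mat M′⊆M = record
  { functional = λ p q → functional mat (M′⊆M p) (M′⊆M q)
  ; injective  = λ p q → injective mat (M′⊆M p) (M′⊆M q)
  }

matched⇒¬falsified : ∀ {M a b} → IsMatching M → (a , b) ∈ M → ¬ Falsified M (pos (a , b))
matched⇒¬falsified mat ab∈ fal with find fal
... | _ , cd∈ , inj₁ (refl , d≢b) = d≢b (sym (functional mat ab∈ cd∈))
... | _ , cd∈ , inj₂ (refl , c≢a) = c≢a (sym (injective mat ab∈ cd∈))

falsified-at-free-pigeon : ∀ {M i j} → i ∉ pigeons M → Falsified M (pos (i , j)) → j ∈ holes M
falsified-at-free-pigeon i∉ fal with find fal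
... | _ , cd∈ , inj₁ (refl , _) = ⊥-elim (i∉ (∈-map⁺ proj₁ cd∈))
... | _ , cd∈ , inj₂ (refl , _) = ∈-map⁺ proj₂ cd∈

falsified-row⇒≤length : ∀ {M n i} → IsMatching M → (∀ {a b} → (a , b) ∈ M → b < n) →
  (∀ {j} → j < n → Falsified M (pos (i , j))) → n ≤ length M
falsified-row⇒≤length {M} {n} {i} mat bounded row with i ∈? pigeons M
... | yes i∈ with ∈-map⁻ proj₁ i∈
...   | (_ , b) , ib∈ , refl = ⊥-elim (matched⇒¬falsified mat ib∈ (row (bounded ib∈)))
falsified-row⇒≤length {M} {n} mat bounded row | no i∉ =
  subst (n ≤_) (length-map proj₂ M)
        (all<⇒≤length n (holes M) (falsified-at-free-pigeon i∉ ∘ row))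

transpose : List Var → List Var
transpose = map swap

∈-transpose⁻ : ∀ {M a b} → (a , b) ∈ transpose M → (b , a) ∈ M
∈-transpose⁻ p with ∈-map⁻ swap p
... | _ , ba∈ , refl = ba∈

transpose-matching : ∀ {M} → IsMatching M → IsMatching (transpose M)
transpose-matching mat = record
  { functional = λ p q → injective mat (∈-transpose⁻ p) (∈-transpose⁻ q)
  ; injective  = λ p q → functional mat (∈-transpose⁻ p) (∈-transpose⁻ q)
  }

falsified-transpose : ∀ {M a b} → Falsified M (pos (a , b)) → Falsified (transpose M) (pos (b , a))
falsified-transpose = Any.map⁺ ∘ Any.map Sum.swap

-- The axioms of OFPHP

∈-map-upTo⁻ : ∀ {A : Set} {N} {x : A} (f : ℕ → A) → x ∈ map f (upTo N) → ∃ λ i → i < N × x ≡ f i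
∈-map-upTo⁻ f x∈ with i , i∈ , refl ← ∈-map⁻ f x∈ = i , ∈-upTo⁻ i∈ , refl

∈-pair-clauses⁻ : ∀ {D N n} (f : ℕ → ℕ → ℕ → Clause Var) →
  D ∈ concatMap (λ x → map (λ p → f x (proj₁ p) (proj₂ p)) (distinctPairs n)) (upTo N) →
  ∃ λ x → ∃ λ y₁ → ∃ λ y₂ → x < N × y₁ < n × y₂ < n × y₁ ≢ y₂ × D ≡ f x y₁ y₂
∈-pair-clauses⁻ {n = n} f D∈
  with x , x∈ , D∈ₓ ← find (∈-concatMap⁻ (λ x → map (λ p → f x (proj₁ p) (proj₂ p)) (distinctPairs n)) D∈)
  with (y₁ , y₂) , p∈ , refl ← ∈-map⁻ (λ p → f x (proj₁ p) (proj₂ p)) D∈ₓ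
  with p∈pairs , y₁≢y₂ ← ∈-filter⁻ (λ p → ¬? (proj₁ p ≟ proj₂ p)) p∈
  with y₁ , y₁∈ , p∈ₓ ← find (∈-concatMap⁻ (λ a → map (a ,_) (upTo n)) p∈pairs)
  with _ , y₂∈ , refl ← ∈-map⁻ (y₁ ,_) p∈ₓ =
  x , y₁ , y₂ , ∈-upTo⁻ x∈ , ∈-upTo⁻ y₁∈ , ∈-upTo⁻ y₂∈ , y₁≢y₂ , refl

module _ (m k : ℕ) where

  InRange : Var → Set
  InRange (a , b) = a < m × b < k

  data Axiom : Clause Var → Set where
    pigeon              : ∀ {i} → i < m → Axiom (map (λ j → pos (i , j)) (upTo k))
    one-pigeon-per-hole : ∀ {i₁ i₂ j} → i₁ < m → i₂ < m → j < k → i₁ ≢ i₂ →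
                          Axiom (neg (i₁ , j) ∷ neg (i₂ , j) ∷ [])
    one-hole-per-pigeon : ∀ {i j₁ j₂} → i < m → j₁ < k → j₂ < k → j₁ ≢ j₂ →
                          Axiom (neg (i , j₁) ∷ neg (i , j₂) ∷ [])
    onto                : ∀ {j} → j < k → Axiom (map (λ i → pos (i , j)) (upTo m))

  axiom : ∀ {D} → D ∈ OFPHP m k → Axiom D
  axiom D∈ with ∈-++⁻ (PHP m k) D∈
  axiom D∈ | inj₁ D∈PHP with ∈-++⁻ (map (λ i → map (λ j → pos (i , j)) (upTo k)) (upTo m)) D∈PHP
  ... | inj₁ D∈′ with i , i<m , refl ← ∈-map-upTo⁻ (λ i → map (λ j → pos (i , j)) (upTo k)) D∈′ =
    pigeon i<m
  ... | inj₂ D∈′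
    with j , i₁ , i₂ , j<k , i₁<m , i₂<m , i₁≢i₂ , refl
           ← ∈-pair-clauses⁻ {N = k} {n = m} (λ j i₁ i₂ → neg (i₁ , j) ∷ neg (i₂ , j) ∷ []) D∈′ =
    one-pigeon-per-hole i₁<m i₂<m j<k i₁≢i₂
  axiom D∈ | inj₂ D∈′
    with ∈-++⁻ (concatMap (λ i → map (λ p → neg (i , proj₁ p) ∷ neg (i , proj₂ p) ∷ [])
                                      (distinctPairs k)) (upTo m)) D∈′
  ... | inj₁ D∈″
    with i , j₁ , j₂ , i<m , j₁<k , j₂<k , j₁≢j₂ , refl
           ← ∈-pair-clauses⁻ {N = m} {n = k} (λ i j₁ j₂ → neg (i , j₁) ∷ neg (i , j₂) ∷ []) D∈″ =
    one-hole-per-pigeon i<m j₁<k j₂<k j₁≢j₂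
  ... | inj₂ D∈″ with j , j<k , refl ← ∈-map-upTo⁻ (λ j → map (λ i → pos (i , j)) (upTo m)) D∈″ =
    onto j<k

  axiom-in-range : ∀ {D l} → Axiom D → l ∈ D → InRange (var l)
  axiom-in-range (pigeon i<m) l∈ with j , j<k , refl ← ∈-map-upTo⁻ _ l∈ = i<m , j<k
  axiom-in-range (onto j<k)   l∈ with i , i<m , refl ← ∈-map-upTo⁻ _ l∈ = i<m , j<k
  axiom-in-range (one-pigeon-per-hole i₁<m _ j<k _) (here refl)         = i₁<m , j<k
  axiom-in-range (one-pigeon-per-hole _ i₂<m j<k _) (there (here refl)) = i₂<m , j<k
  axiom-in-range (one-hole-per-pigeon i<m j₁<k _ _) (here refl)         = i<m , j₁<k
  axiom-in-range (one-hole-per-pigeon i<m _ j₂<k _) (there (here refl)) = i<m , j₂<k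

  leaf-axiom : ∀ {C} → C ∈CS OFPHP m k → ∃ λ D → Axiom D × C ≈ D
  leaf-axiom C∈ with D , D∈ , C≈D ← find C∈ = D , axiom D∈ , C≈D

  labels-in-range : ∀ T → ValidTree T → LeavesIn (OFPHP m k) T → ∀ {l} → l ∈ label T → InRange (var l)
  labels-in-range = label-literals-from-leaves (InRange ∘ var) leaf-in-range
    where
    leaf-in-range : ∀ {C l} → C ∈CS OFPHP m k → l ∈ C → InRange (var l)
    leaf-in-range {l = l} C∈ l∈ =
      let _ , ax , C≈D = leaf-axiom C∈ in axiom-in-range ax (Equivalence.to (C≈D l) l∈)

  record SmallMatching (M : List Var) : Set where
    field
      isMatching : IsMatching M
      inRange    : ∀ {v} → v ∈ M → InRange v
      small      : length M < k
  open SmallMatching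

  Falsifiable : Clause Var → Set
  Falsifiable D = ∃ λ M → SmallMatching M × All (Falsified M) D

  []-small : 0 < k → SmallMatching []
  []-small 0<k = record
    { isMatching = record { functional = λ () ; injective = λ () }
    ; inRange    = λ ()
    ; small      = 0<k
    }

  ⊆-small : ∀ {M M′} → SmallMatching M → M′ ⊆ M → length M′ < k → SmallMatching M′
  ⊆-small sm M′⊆M short = record
    { isMatching = ⊆-matching (isMatching sm) M′⊆M
    ; inRange    = inRange sm ∘ M′⊆M
    ; small      = short
    }

  ∷-small : ∀ {M v} → SmallMatching M → suc (length M) < k → InRange v → Free M v →
    SmallMatching (v ∷ M)
  ∷-small sm short v-in free = record
    { isMatching = ∷-matching (isMatching sm) free
    ; inRange    = λ { (here refl) → v-in ; (there p) → inRange sm p }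
    ; small      = short
    }

  axiom-unfalsifiable : ∀ {D M} → k < m → Axiom D → SmallMatching M → ¬ All (Falsified M) D
  axiom-unfalsifiable _ (pigeon {i} _) sm fal =
    <⇒≱ (small sm) (falsified-row⇒≤length (isMatching sm) (proj₂ ∘ inRange sm) row)
    where
    row : ∀ {j} → j < k → Falsified _ (pos (i , j))
    row j<k = All.lookup fal (∈-map⁺ _ (∈-upTo⁺ j<k))
  axiom-unfalsifiable {M = M} k<m (onto {j} _) sm fal =
    <⇒≱ (<-trans (small sm) k<m)
      (subst (m ≤_) (length-map swap M)
        (falsified-row⇒≤length (transpose-matching (isMatching sm))
                               (proj₁ ∘ inRange sm ∘ ∈-transpose⁻) column))
    where
    column : ∀ {i} → i < m → Falsified (transpose M) (pos (j , i))
    column i<m = falsified-transpose (All.lookup fal (∈-map⁺ _ (∈-upTo⁺ i<m)))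
  axiom-unfalsifiable _ (one-pigeon-per-hole _ _ _ i₁≢i₂) sm (i₁j∈ ∷ i₂j∈ ∷ []) =
    i₁≢i₂ (injective (isMatching sm) i₁j∈ i₂j∈)
  axiom-unfalsifiable _ (one-hole-per-pigeon _ _ _ j₁≢j₂) sm (ij₁∈ ∷ ij₂∈ ∷ []) =
    j₁≢j₂ (functional (isMatching sm) ij₁∈ ij₂∈)

  -- The Delayer's strategy

  module _ (k<m : k < m) where

    falsify-free-literal : ∀ {M} l → SmallMatching M → suc (length M) < k →
      InRange (var l) → Free M (var l) → ∃ λ e → SmallMatching (e ∷ M) × Blocks l e
    falsify-free-literal (neg v) sm short v-in free = v , ∷-small sm short v-in free , refl
    falsify-free-literal {M} (pos (a , b)) sm short (_ , b<k) (_ , b∉)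
      with a′ , a′<m , a′∉ ← length<⇒∃∉ m (a ∷ pigeons M)
                                 (subst (λ n → suc n < m) (sym (length-map proj₁ M)) (<-trans short k<m)) =
      (a′ , b) , ∷-small sm short (a′<m , b<k) (a′∉ ∘ there , b∉) , inj₂ (refl , a′∉ ∘ here)

    falsify-short : ∀ {M D l} → SmallMatching M → l ∈ D → InRange (var l) → Free M (var l) →
      FalsifiedExcept M D l → length D < k → Falsifiable D
    falsify-short sm l∈D l-in free others short =
      let M′ , M′⊆M , M′<D , others′ = shrink-witnesses l∈D others
          M′+1<k = ≤-<-trans M′<D short
          e , sm′ , blocks = falsify-free-literal _ (⊆-small sm M′⊆M (<-trans (n<1+n _) M′+1<k))
                                                  M′+1<k l-in (free-⊆ M′⊆M free)
      in e ∷ M′ , sm′ , falsify-pivot (here blocks) (λ l′∈ l′≢l → there (others′ l′∈ l′≢l))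

    step-on-pivot : ∀ {C₁ C₂ C M} x → x ∈ C₁ → compl x ∈ C₂ → InRange (var x) →
      (∀ {l} → l ∈ C₁ → l ≢ x → l ∈ C) → (∀ {l} → l ∈ C₂ → l ≢ compl x → l ∈ C) →
      length C₁ < k ⊎ length C₂ < k →
      SmallMatching M → All (Falsified M) C → Falsifiable C₁ ⊎ Falsifiable C₂
    step-on-pivot {M = M} x x∈ x̄∈ x-in sub₁ sub₂ short sm fal
      with Falsified? M x | Falsified? M (compl x) | short
    ... | yes fal-x | _ | _ = inj₁ (M , sm , falsify-pivot fal-x (λ p q → All.lookup fal (sub₁ p q)))
    ... | no _ | yes fal-x̄ | _ = inj₂ (M , sm , falsify-pivot fal-x̄ (λ p q → All.lookup fal (sub₂ p q)))
    ... | no ¬fal-x | no ¬fal-x̄ | inj₁ short₁ =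
      inj₁ (falsify-short sm x∈ x-in (undecided⇒free x ¬fal-x ¬fal-x̄)
                          (λ p q → All.lookup fal (sub₁ p q)) short₁)
    ... | no ¬fal-x | no ¬fal-x̄ | inj₂ short₂ =
      inj₂ (falsify-short sm x̄∈ (subst InRange (sym (var-compl x)) x-in)
                          (subst (Free M) (sym (var-compl x)) (undecided⇒free x ¬fal-x ¬fal-x̄))
                          (λ p q → All.lookup fal (sub₂ p q)) short₂)

    resolution-step : ∀ {C₁ C₂ C M} → IsClause C₁ → IsClause C₂ → IsResolvent C₁ C₂ C →
      (∀ {l} → l ∈ C₁ → InRange (var l)) → length C₁ ⊓ length C₂ < k →
      SmallMatching M → All (Falsified M) C → Falsifiable C₁ ⊎ Falsifiable C₂
    resolution-step clause₁ clause₂ res in-range narrow =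
      let x , x∈ , x̄∈ , sub₁ , sub₂ = resolvent⊇ clause₁ clause₂ res
      in step-on-pivot x x∈ x̄∈ (in-range x∈) sub₁ sub₂ (m⊓n<o⇒m<o⊎n<o narrow)

    narrow-tree-unfalsifiable : ∀ T {M} → ValidTree T → LeavesIn (OFPHP m k) T → whdT T < k →
      SmallMatching M → ¬ All (Falsified M) (label T)
    narrow-tree-unfalsifiable (leaf C) _ C∈ _ sm fal =
      let D , ax , C≈D = leaf-axiom C∈
      in axiom-unfalsifiable k<m ax sm (All.tabulate (All.lookup fal ∘ Equivalence.from (C≈D _)))
    narrow-tree-unfalsifiable (node C t₁ t₂) (_ , res , v₁ , v₂) (lv₁ , lv₂) narrow sm fal =
      let narrow₁ , narrow₂ , narrow-step = whdT-node< {C = C} t₁ t₂ narrow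
      in Sum.[ (λ (_ , sm₁ , fal₁) → narrow-tree-unfalsifiable t₁ v₁ lv₁ narrow₁ sm₁ fal₁)
             , (λ (_ , sm₂ , fal₂) → narrow-tree-unfalsifiable t₂ v₂ lv₂ narrow₂ sm₂ fal₂) ]
             (resolution-step (valid-label t₁ v₁) (valid-label t₂ v₂) res
                              (labels-in-range t₁ v₁ lv₁) narrow-step sm fal)

lemma8p3 : (m k : ℕ) → k < m →
    (T : Tree Var) → IsRefutation (OFPHP m k) T → k ≤ whdT T
lemma8p3 m k k<m T (valid , leaves , root≡⊥) = ≮⇒≥ λ narrow →
  narrow-tree-unfalsifiable m k k<m T valid leaves narrow ([]-small m k (≤-<-trans z≤n narrow))
                            (subst (All _) (sym root≡⊥) [])
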